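{- Let $\lambda_1,\lambda_2,\ldots$ be independent indeterminates and $\mathbb{Z}[\lambda]=\mathbb{Z}[\lambda_1,\lambda_2,\ldots]$. For $m\geq 0$ let $\mu_m=\sum_\omega\prod_j \lambda_{\omega(j)}$, where $\omega$ ranges over all maps $\omega:\{1,\ldots,m+1\}\to\{0,1,2,\ldots\}$ with $\omega(1)=\omega(m+1)=0$ and $|\omega(i+1)-\omega(i)|=1$ for all $1\leq i\leq m$, and the product is over those $j\in\{1,\ldots,m\}$ with $\omega(j+1)-\omega(j)=-1$ (so $\mu_m=0$ for $m$ odd). Put $s_k=\lambda_1\lambda_2\cdots\lambda_k$, $s_0=1$. Then for every $n\geq0$, over $\mathbb{Z}[\lambda]$: (i) $(\mu_{i+j})_{0\leq i,j\leq n}$ has special Smith normal form $\mathrm{diag}(s_0,s_1,\ldots,s_n)$; (ii) $(\mu_{2i+2j})_{0\leq i,j\leq n}$ has special Smith normal form $\mathrm{diag}(s_0,s_2,s_4,\ldots,s_{2n})$; (iii) $(\mu_{2i+2j+2})_{0\leq i,j\leq n}$ has special Smith normal form $\mathrm{diag}(s_1,s_3,s_5,\ldots,s_{2n+1})$.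
   Context: For an $m\times n$ matrix $A$ over a commutative ring $R$, a matrix $D$ is a special Smith normal form (SSNF) of $A$ over $R$ if there exist $P\in \mathrm{SL}(m,R)$, $Q\in\mathrm{SL}(n,R)$ (determinant $1$) with $PAQ=D$, $D$ is diagonal, and $d_{ii}$ is a multiple in $R$ of $d_{jj}$ whenever $i\geq j$. -}

module Defs where

open import Data.Nat using (ℕ; zero; suc; _≤_; _≟_)
open import Data.Empty using (⊥)
open import Relation.Nullary using (yes; no; ¬_)
open import Data.Integer using (ℤ; +_; -[1+_]) renaming (_+_ to _+ℤ_; _*_ to _*ℤ_; -_ to -ℤ_)
open import Data.Fin using (Fin; zero; suc; toℕ; punchIn)
open import Data.Bool using (Bool; true; false)
open import Data.List using (List; []; _∷_; map; _++_)
open import Data.Maybe using (Maybe; just; nothing)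
open import Data.Product using (Σ; _×_; ∃)
open import Relation.Binary.PropositionalEquality using (_≡_)

-- The polynomial ring ℤ[λ] = ℤ[λ₁, λ₂, …]
-- Elements are formal ring expressions; two expressions are equal in ℤ[λ]
-- iff they agree under every integer evaluation of the variables
-- (this is exactly the free commutative ring on countably many generators,
-- since ℤ is an infinite integral domain).
-- `var k` is λ_k (k ≥ 1); `var 0` is simply never used below.

infixl 6 _⊕_
infixl 7 _⊗_

data Poly : Set where
  con : ℤ → Poly
  var : ℕ → Poly
  _⊕_ : Poly → Poly → Poly
  _⊗_ : Poly → Poly → Poly
  ⊖_  : Poly → Poly

⟦_⟧ : Poly → (ℕ → ℤ) → ℤ
⟦ con c ⟧ ρ = c
⟦ var k ⟧ ρ = ρ k
⟦ p ⊕ q ⟧ ρ = ⟦ p ⟧ ρ +ℤ ⟦ q ⟧ ρ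
⟦ p ⊗ q ⟧ ρ = ⟦ p ⟧ ρ *ℤ ⟦ q ⟧ ρ
⟦ ⊖ p ⟧ ρ = -ℤ ⟦ p ⟧ ρ

infix 4 _≈_
_≈_ : Poly → Poly → Set
p ≈ q = ∀ (ρ : ℕ → ℤ) → ⟦ p ⟧ ρ ≡ ⟦ q ⟧ ρ

𝟘 𝟙 : Poly
𝟘 = con (+ 0)
𝟙 = con (+ 1)

_∣ₚ_ : Poly → Poly → Set
a ∣ₚ b = Σ Poly (λ c → c ⊗ a ≈ b)

Mat : ℕ → ℕ → Set
Mat m n = Fin m → Fin n → Poly

Σᶠ : ∀ {n} → (Fin n → Poly) → Poly
Σᶠ {zero} f = 𝟘
Σᶠ {suc n} f = f zero ⊕ Σᶠ (λ i → f (suc i))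

_·_ : ∀ {m k n} → Mat m k → Mat k n → Mat m n
(A · B) i j = Σᶠ (λ l → A i l ⊗ B l j)

_≈ₘ_ : ∀ {m n} → Mat m n → Mat m n → Set
A ≈ₘ B = ∀ i j → A i j ≈ B i j

sgn : ℕ → Poly
sgn zero = 𝟙
sgn (suc k) = ⊖ sgn k

det : ∀ {n} → Mat n n → Poly
det {zero} M = 𝟙
det {suc n} M =
  Σᶠ (λ j → sgn (toℕ j) ⊗ (M zero j ⊗ det (λ r c → M (suc r) (punchIn j c))))

IsDiagonal : ∀ {m n} → Mat m n → Set
IsDiagonal {m} {n} D = ∀ (i : Fin m) (j : Fin n) → ¬ (toℕ i ≡ toℕ j) → D i j ≈ 𝟘

IsSSNF : ∀ {m n} → Mat m n → Mat m n → Set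
IsSSNF {m} {n} A D =
  Σ (Mat m m) (λ P → Σ (Mat n n) (λ Q →
     det P ≈ 𝟙 × det Q ≈ 𝟙 × ((P · A) · Q) ≈ₘ D))
  × IsDiagonal D
  × (∀ (i j : Fin m) (i' j' : Fin n) → toℕ i ≡ toℕ i' → toℕ j ≡ toℕ j' →
       toℕ j ≤ toℕ i → D j j' ∣ₚ D i i')

diag : ∀ {n} → (Fin n → Poly) → Mat n n
diag d i j with toℕ i ≟ toℕ j
... | yes _ = d i
... | no _ = 𝟘

-- A map ω : {1..m+1} → ℕ with ω(1)=0 and |ω(i+1)-ω(i)|=1 is the same as a
-- sequence of m steps (true = up, false = down) from height 0 whose heights
-- stay ≥ 0.  `walk h steps` returns the weight ∏ λ_{ω(j)} over down steps j
-- (ω(j) = height before the step) if the path is admissible (never negative,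
-- ends at height 0), and `nothing` otherwise.

walk : ℕ → List Bool → Maybe Poly
walk zero [] = just 𝟙
walk (suc h) [] = nothing
walk h (true ∷ bs) = walk (suc h) bs
walk zero (false ∷ bs) = nothing
walk (suc h) (false ∷ bs) with walk h bs
... | just w = just (var (suc h) ⊗ w)
... | nothing = nothing

allSeqs : ℕ → List (List Bool)
allSeqs zero = [] ∷ []
allSeqs (suc m) = map (true ∷_) (allSeqs m) ++ map (false ∷_) (allSeqs m)

sumWeights : List (List Bool) → Poly
sumWeights [] = 𝟘
sumWeights (bs ∷ bss) with walk 0 bs
... | just w = w ⊕ sumWeights bss
... | nothing = sumWeights bss

μ : ℕ → Poly
μ m = sumWeights (allSeqs m)

s : ℕ → Poly
s zero = 𝟙
s (suc k) = s k ⊗ var (suc k)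

module Submission where

-- Read μ_m as the total weight of Dyck paths of length m, a down
-- step from height h+1 weighing λ_{h+1}.  Let ballot i k be the weight of the
-- i-step paths from height 0 to height k, and toGround j k that of the j-step
-- paths from height k down to 0.  Cutting a Dyck path of length i + j after i
-- steps gives  μ_{i+j} = Σ_k ballot i k · toGround j k,  and reading a path
-- backwards gives  toGround j k = s_k · ballot j k.  Hence the Hankel matrix
-- factors as  (μ_{i+j}) = L · diag(s_k) · Lᵀ  with L = (ballot i k) lower
-- unitriangular, so P = L⁻¹ and Q = (L⁻¹)ᵀ (both of determinant 1) bring it to
-- diag(s_0, …, s_n).  Since ballot i k vanishes when i + k is odd, restricting
-- the factorisation to even (resp. odd) indices gives parts (ii) and (iii).

open import Defs
open import Data.Nat using (ℕ; suc; _+_; _*_)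
open import Data.Fin using (Fin; toℕ)
open import Data.Product using (_×_)

open import Data.Nat using (zero; _≤_; _<_; _≤′_; ≤′-refl; ≤′-step; z≤n; s≤s; parity)
import Data.Nat.Properties as ℕₚ
open import Data.Nat.Tactic.RingSolver as ℕ-Solver using ()
open import Data.Parity using (0ℙ; 1ℙ) renaming (_+_ to _+ℙ_)
import Data.Parity.Properties as Parityₚ
open import Data.Integer using (ℤ; +_; +0; -_) renaming (_+_ to _+ᶻ_; _*_ to _*ᶻ_)
import Data.Integer.Properties as ℤₚ
open import Data.Integer.Tactic.RingSolver using (solve-∀)
open import Data.Fin using (zero; suc; punchIn)
import Data.Fin.Properties as Finₚ
open import Data.Bool using (Bool; true; false)
open import Data.List using (List; []; _∷_; map; _++_)
open import Data.Maybe using (Maybe; just; nothing)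
open import Data.Product using (_,_)
open import Data.Sum using (inj₁; inj₂)
open import Relation.Nullary using (yes; no; ¬_)
open import Relation.Binary.Core using (_Preserves_⟶_)
open import Relation.Binary.PropositionalEquality
open import Data.Empty using (⊥-elim)
open import Algebra.Properties.Semiring.Sum ℤₚ.+-*-semiring
  using (sum; ∑-comm; *-distribˡ-sum; *-distribʳ-sum; sum-replicate-zero)
  renaming (sum-cong-≗ to sum-cong)

open ≡-Reasoning

sum-zero : ∀ {n} (f : Fin n → ℤ) → (∀ i → f i ≡ +0) → sum f ≡ +0
sum-zero {n} f f≡0 = trans (sum-cong f≡0) (sum-replicate-zero n)

⟦Σᶠ⟧ : ∀ {n} (f : Fin n → Poly) ρ → ⟦ Σᶠ f ⟧ ρ ≡ sum (λ i → ⟦ f i ⟧ ρ)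
⟦Σᶠ⟧ {zero} f ρ = refl
⟦Σᶠ⟧ {suc n} f ρ = cong (⟦ f zero ⟧ ρ +ᶻ_) (⟦Σᶠ⟧ (λ i → f (suc i)) ρ)

sumTo : ℕ → (ℕ → ℤ) → ℤ
sumTo N g = sum {N} (λ k → g (toℕ k))

sumTo-cong : ∀ N {f g : ℕ → ℤ} → (∀ k → f k ≡ g k) → sumTo N f ≡ sumTo N g
sumTo-cong N f≡g = sum-cong {N} (λ k → f≡g (toℕ k))

sumTo-zero : ∀ N (g : ℕ → ℤ) → (∀ k → g k ≡ +0) → sumTo N g ≡ +0
sumTo-zero N g g≡0 = sum-zero {N} _ (λ k → g≡0 (toℕ k))

sumTo-last : ∀ N g → sumTo (suc N) g ≡ sumTo N g +ᶻ g N
sumTo-last zero g = trans (ℤₚ.+-identityʳ (g 0)) (sym (ℤₚ.+-identityˡ (g 0)))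
sumTo-last (suc N) g =
  trans (cong (g 0 +ᶻ_) (sumTo-last N (λ k → g (suc k)))) (sym (ℤₚ.+-assoc (g 0) _ _))

sumTo-parity-split : ∀ N g →
  sumTo (2 * N) g ≡ sumTo N (λ k → g (2 * k)) +ᶻ sumTo N (λ k → g (2 * k + 1))
sumTo-parity-split zero g = refl
sumTo-parity-split (suc N) g =
  begin
    sumTo (2 * suc N) g
  ≡⟨ cong (λ m → sumTo m g) (ℕₚ.*-suc 2 N) ⟩
    g 0 +ᶻ (g 1 +ᶻ sumTo (2 * N) (λ k → g (2 + k)))
  ≡⟨ cong (λ x → g 0 +ᶻ (g 1 +ᶻ x)) (sumTo-parity-split N (λ k → g (2 + k))) ⟩
    g 0 +ᶻ (g 1 +ᶻ (sumTo N (λ k → g (2 + 2 * k)) +ᶻ sumTo N (λ k → g (2 + (2 * k + 1)))))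
  ≡⟨ interleave (g 0) (g 1) _ _ ⟩
    (g 0 +ᶻ sumTo N (λ k → g (2 + 2 * k))) +ᶻ (g 1 +ᶻ sumTo N (λ k → g (2 + (2 * k + 1))))
  ≡⟨ cong₂ (λ x y → (g 0 +ᶻ x) +ᶻ (g 1 +ᶻ y))
       (sumTo-cong N (λ k → cong g (sym (ℕₚ.*-suc 2 k))))
       (sumTo-cong N (λ k → cong (λ m → g (m + 1)) (sym (ℕₚ.*-suc 2 k)))) ⟩
    sumTo (suc N) (λ k → g (2 * k)) +ᶻ sumTo (suc N) (λ k → g (2 * k + 1))
  ∎
  where
  interleave : ∀ a b x y → a +ᶻ (b +ᶻ (x +ᶻ y)) ≡ (a +ᶻ x) +ᶻ (b +ᶻ y)
  interleave = solve-∀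

contract-congruence : ∀ {n} (u v e : Fin n → ℤ) (l : Fin n → Fin n → ℤ) →
  sum (λ b → sum (λ a → u a *ᶻ sum (λ k → l a k *ᶻ (e k *ᶻ l b k))) *ᶻ v b)
  ≡ sum (λ k → sum (λ a → u a *ᶻ l a k) *ᶻ (e k *ᶻ sum (λ b → v b *ᶻ l b k)))
contract-congruence {n} u v e l =
  begin
    sum (λ b → sum (λ a → u a *ᶻ sum (λ k → l a k *ᶻ (e k *ᶻ l b k))) *ᶻ v b)
  ≡⟨ sum-cong (λ b → trans (*-distribʳ-sum (v b) (λ a → u a *ᶻ sum (λ k → l a k *ᶻ (e k *ᶻ l b k))))
       (sum-cong (λ a → expand a b))) ⟩
    sum (λ b → sum (λ a → sum (λ k → F a b k)))
  ≡⟨ sum-cong (λ b → ∑-comm (λ a k → F a b k)) ⟩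
    sum (λ b → sum (λ k → sum (λ a → F a b k)))
  ≡⟨ ∑-comm (λ b k → sum (λ a → F a b k)) ⟩
    sum (λ k → sum (λ b → sum (λ a → F a b k)))
  ≡⟨ sum-cong (λ k → ∑-comm (λ b a → F a b k)) ⟩
    sum (λ k → sum (λ a → sum (λ b → F a b k)))
  ≡⟨ sum-cong (λ k → sym (factor k)) ⟩
    sum (λ k → sum (λ a → u a *ᶻ l a k) *ᶻ (e k *ᶻ sum (λ b → v b *ᶻ l b k)))
  ∎
  where
  F : Fin n → Fin n → Fin n → ℤ
  F a b k = (u a *ᶻ l a k) *ᶻ (e k *ᶻ (v b *ᶻ l b k))
  regroup : ∀ x la ek lb y → x *ᶻ (la *ᶻ (ek *ᶻ lb)) *ᶻ y ≡ (x *ᶻ la) *ᶻ (ek *ᶻ (y *ᶻ lb))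
  regroup = solve-∀
  expand : ∀ a b → u a *ᶻ sum (λ k → l a k *ᶻ (e k *ᶻ l b k)) *ᶻ v b ≡ sum (λ k → F a b k)
  expand a b = trans (cong (_*ᶻ v b) (*-distribˡ-sum (u a) (λ k → l a k *ᶻ (e k *ᶻ l b k))))
    (trans (*-distribʳ-sum (v b) (λ k → u a *ᶻ (l a k *ᶻ (e k *ᶻ l b k)))) (sum-cong (λ k → regroup (u a) (l a k) (e k) (l b k) (v b))))
  factor : ∀ k → sum (λ a → u a *ᶻ l a k) *ᶻ (e k *ᶻ sum (λ b → v b *ᶻ l b k))
                 ≡ sum (λ a → sum (λ b → F a b k))
  factor k = trans (*-distribʳ-sum (e k *ᶻ sum (λ b → v b *ᶻ l b k)) (λ a → u a *ᶻ l a k)) (sum-cong (λ a →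
    trans (cong ((u a *ᶻ l a k) *ᶻ_) (*-distribˡ-sum (e k) (λ b → v b *ᶻ l b k)))
      (*-distribˡ-sum (u a *ᶻ l a k) (λ b → e k *ᶻ (v b *ᶻ l b k)))))

δ : ∀ {n} → Fin n → Fin n → ℤ
δ zero zero = + 1
δ zero (suc _) = +0
δ (suc _) zero = +0
δ (suc i) (suc j) = δ i j

sum-δ : ∀ {n} (i : Fin n) (g : Fin n → ℤ) → sum (λ k → δ i k *ᶻ g k) ≡ g i
sum-δ {suc n} zero g =
  trans (cong (+ 1 *ᶻ g zero +ᶻ_) (sum-zero {n} (λ k → +0 *ᶻ g (suc k)) (λ _ → refl)))
    (trans (ℤₚ.+-identityʳ (+ 1 *ᶻ g zero)) (ℤₚ.*-identityˡ (g zero)))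
sum-δ (suc i) g =
  trans (ℤₚ.+-identityˡ (sum (λ k → δ i k *ᶻ g (suc k)))) (sum-δ i (λ k → g (suc k)))

diag-on-diagonal : ∀ {n} (d : Fin n → Poly) i j → toℕ i ≡ toℕ j → diag d i j ≡ d i
diag-on-diagonal d i j i≡j with toℕ i ℕₚ.≟ toℕ j
... | yes _ = refl
... | no i≢j = ⊥-elim (i≢j i≡j)

diag-isDiagonal : ∀ {n} (d : Fin n → Poly) → IsDiagonal (diag d)
diag-isDiagonal d i j i≢j with toℕ i ℕₚ.≟ toℕ j
... | yes i≡j = ⊥-elim (i≢j i≡j)
... | no _ = λ ρ → refl

diag-δ : ∀ {n} (d : Fin n → Poly) ρ i j → ⟦ d i ⟧ ρ *ᶻ δ j i ≡ ⟦ diag d i j ⟧ ρ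
diag-δ d ρ i j with toℕ i ℕₚ.≟ toℕ j
... | yes i≡j rewrite Finₚ.toℕ-injective i≡j =
  trans (cong (⟦ d j ⟧ ρ *ᶻ_) (δ-refl j)) (ℤₚ.*-identityʳ _)
  where
  δ-refl : ∀ {n} (i : Fin n) → δ i i ≡ + 1
  δ-refl zero = refl
  δ-refl (suc i) = δ-refl i
... | no i≢j =
  trans (cong (⟦ d i ⟧ ρ *ᶻ_) (δ-off j i (λ e → i≢j (cong toℕ (sym e))))) (ℤₚ.*-zeroʳ (⟦ d i ⟧ ρ))
  where
  δ-off : ∀ {n} (i j : Fin n) → ¬ (i ≡ j) → δ i j ≡ +0
  δ-off zero zero i≢j = ⊥-elim (i≢j refl)
  δ-off zero (suc j) _ = refl
  δ-off (suc i) zero _ = refl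
  δ-off (suc i) (suc j) i≢j = δ-off i j (λ e → i≢j (cong suc e))

minor : ∀ {n} → Mat (suc n) (suc n) → Fin (suc n) → Mat n n
minor M j r c = M (suc r) (punchIn j c)

transpose : ∀ {n} → Mat n n → Mat n n
transpose M i j = M j i

cofactor-vanishes : ∀ k x y ρ → ⟦ x ⊗ y ⟧ ρ ≡ +0 → ⟦ sgn k ⊗ (x ⊗ y) ⟧ ρ ≡ +0
cofactor-vanishes k x y ρ xy≡0 = trans (cong (⟦ sgn k ⟧ ρ *ᶻ_) xy≡0) (ℤₚ.*-zeroʳ (⟦ sgn k ⟧ ρ))

det-first-term : ∀ {n} (M : Mat (suc n) (suc n)) ρ →
  (∀ j → ⟦ sgn (toℕ (suc j)) ⊗ (M zero (suc j) ⊗ det (minor M (suc j))) ⟧ ρ ≡ +0) →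
  ⟦ det M ⟧ ρ ≡ ⟦ M zero zero ⊗ det (minor M zero) ⟧ ρ
det-first-term {n} M ρ rest≡0 =
  trans (cong (+ 1 *ᶻ first +ᶻ_) (trans (⟦Σᶠ⟧ cofactor ρ) (sum-zero (λ j → ⟦ cofactor j ⟧ ρ) rest≡0)))
    (trans (ℤₚ.+-identityʳ (+ 1 *ᶻ first)) (ℤₚ.*-identityˡ first))
  where
  first : ℤ
  first = ⟦ M zero zero ⊗ det (minor M zero) ⟧ ρ
  cofactor : Fin n → Poly
  cofactor j = sgn (toℕ (suc j)) ⊗ (M zero (suc j) ⊗ det (minor M (suc j)))

mutual
  det-zero-column : ∀ {n} (M : Mat (suc n) (suc n)) ρ → (∀ r → ⟦ M r zero ⟧ ρ ≡ +0) →
    ⟦ det M ⟧ ρ ≡ +0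
  det-zero-column M ρ col≡0 =
    trans (det-column-reduce M ρ (λ r → col≡0 (suc r)))
      (trans (cong (_*ᶻ ⟦ det (minor M zero) ⟧ ρ) (col≡0 zero)) (ℤₚ.*-zeroˡ (⟦ det (minor M zero) ⟧ ρ)))

  det-column-reduce : ∀ {n} (M : Mat (suc n) (suc n)) ρ → (∀ r → ⟦ M (suc r) zero ⟧ ρ ≡ +0) →
    ⟦ det M ⟧ ρ ≡ ⟦ M zero zero ⊗ det (minor M zero) ⟧ ρ
  det-column-reduce {zero} M ρ _ = det-first-term M ρ (λ ())
  det-column-reduce {suc n} M ρ col≡0 = det-first-term M ρ (λ j →
    cofactor-vanishes (toℕ (suc j)) (M zero (suc j)) (det (minor M (suc j))) ρ
      (trans (cong (⟦ M zero (suc j) ⟧ ρ *ᶻ_) (det-zero-column (minor M (suc j)) ρ col≡0))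
        (ℤₚ.*-zeroʳ (⟦ M zero (suc j) ⟧ ρ))))

IsLowerUnitriangular : ∀ {n} → (ℕ → ℤ) → Mat n n → Set
IsLowerUnitriangular ρ L =
  (∀ i j → toℕ i < toℕ j → ⟦ L i j ⟧ ρ ≡ +0) × (∀ i → ⟦ L i i ⟧ ρ ≡ + 1)

minor-unitriangular : ∀ {n} ρ (L : Mat (suc n) (suc n)) →
  IsLowerUnitriangular ρ L → IsLowerUnitriangular ρ (minor L zero)
minor-unitriangular ρ L (upper , diagonal) =
  (λ i j i<j → upper (suc i) (suc j) (s≤s i<j)) , (λ i → diagonal (suc i))

-- The inverse of a lower unitriangular matrix by forward substitution: first
-- row e₀, lower-right block the inverse of the minor, and first column chosen
-- so that  inverse L · L  has first column e₀.
inverse : ∀ {n} → Mat n n → Mat n n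
inverse {suc n} L zero zero = 𝟙
inverse {suc n} L zero (suc j) = 𝟘
inverse {suc n} L (suc i) zero = ⊖ Σᶠ (λ l → inverse (minor L zero) i l ⊗ L (suc l) zero)
inverse {suc n} L (suc i) (suc j) = inverse (minor L zero) i j

inverse-first-row : ∀ {n} (L : Mat (suc n) (suc n)) ρ k →
  sum (λ a → ⟦ inverse L zero a ⟧ ρ *ᶻ ⟦ L a k ⟧ ρ) ≡ ⟦ L zero k ⟧ ρ
inverse-first-row {n} L ρ k =
  trans (cong (+ 1 *ᶻ L₀ₖ +ᶻ_) (sum-zero {n} (λ a → +0 *ᶻ ⟦ L (suc a) k ⟧ ρ) (λ _ → refl)))
    (trans (ℤₚ.+-identityʳ (+ 1 *ᶻ L₀ₖ)) (ℤₚ.*-identityˡ L₀ₖ))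
  where
  L₀ₖ = ⟦ L zero k ⟧ ρ

inverse-left : ∀ {n} ρ (L : Mat n n) → IsLowerUnitriangular ρ L →
  ∀ i k → sum (λ a → ⟦ inverse L i a ⟧ ρ *ᶻ ⟦ L a k ⟧ ρ) ≡ δ i k
inverse-left ρ L (upper , diagonal) zero zero = trans (inverse-first-row L ρ zero) (diagonal zero)
inverse-left ρ L (upper , diagonal) zero (suc k) =
  trans (inverse-first-row L ρ (suc k)) (upper zero (suc k) (s≤s z≤n))
inverse-left {suc n} ρ L (upper , diagonal) (suc i) zero =
  trans (cong₂ (λ x y → - x *ᶻ y +ᶻ X) (⟦Σᶠ⟧ column ρ) (diagonal zero)) (cancel X)
  where
  column : Fin n → Poly
  column l = inverse (minor L zero) i l ⊗ L (suc l) zero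
  X : ℤ
  X = sum (λ l → ⟦ column l ⟧ ρ)
  cancel : ∀ x → - x *ᶻ + 1 +ᶻ x ≡ +0
  cancel = solve-∀
inverse-left ρ L hL@(upper , _) (suc i) (suc k) =
  trans (cong (_+ᶻ rest) (trans (cong (Y *ᶻ_) (upper zero (suc k) (s≤s z≤n))) (ℤₚ.*-zeroʳ Y)))
    (trans (ℤₚ.+-identityˡ rest)
      (inverse-left ρ (minor L zero) (minor-unitriangular ρ L hL) i k))
  where
  Y rest : ℤ
  Y = ⟦ inverse L (suc i) zero ⟧ ρ
  rest = sum (λ a → ⟦ inverse (minor L zero) i a ⟧ ρ *ᶻ ⟦ L (suc a) (suc k) ⟧ ρ)

-- Both inverse L and its transpose have determinant 1 (they are triangular
-- with unit diagonal by construction).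
det-inverse : ∀ {n} (L : Mat n n) → det (inverse L) ≈ 𝟙
det-inverse {zero} L ρ = refl
det-inverse {suc n} L ρ =
  trans (det-first-term (inverse L) ρ (λ j →
          cofactor-vanishes (toℕ (suc j)) 𝟘 (det (minor (inverse L) (suc j))) ρ
            (ℤₚ.*-zeroˡ (⟦ det (minor (inverse L) (suc j)) ⟧ ρ))))
    (trans (ℤₚ.*-identityˡ (⟦ det (inverse (minor L zero)) ⟧ ρ)) (det-inverse (minor L zero) ρ))

det-inverse-transpose : ∀ {n} (L : Mat n n) → det (transpose (inverse L)) ≈ 𝟙
det-inverse-transpose {zero} L ρ = refl
det-inverse-transpose {suc n} L ρ =
  trans (det-column-reduce (transpose (inverse L)) ρ (λ _ → refl))
    (trans (ℤₚ.*-identityˡ (⟦ det (transpose (inverse (minor L zero))) ⟧ ρ))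
      (det-inverse-transpose (minor L zero) ρ))

congruence-diagonalises : ∀ {n} (A L : Mat n n) (d : Fin n → Poly) →
  (∀ ρ → IsLowerUnitriangular ρ L) →
  (∀ ρ i j → ⟦ A i j ⟧ ρ ≡ sum (λ k → ⟦ L i k ⟧ ρ *ᶻ (⟦ d k ⟧ ρ *ᶻ ⟦ L j k ⟧ ρ))) →
  ((inverse L · A) · transpose (inverse L)) ≈ₘ diag d
congruence-diagonalises {n} A L d hL hA i j ρ =
  begin
    ⟦ ((inverse L · A) · transpose (inverse L)) i j ⟧ ρ
  ≡⟨ ⟦Σᶠ⟧ (λ b → (inverse L · A) i b ⊗ inverse L j b) ρ ⟩
    sum (λ b → ⟦ (inverse L · A) i b ⟧ ρ *ᶻ p j b)
  ≡⟨ sum-cong (λ b → cong (_*ᶻ p j b) (trans (⟦Σᶠ⟧ (λ a → inverse L i a ⊗ A a b) ρ)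
       (sum-cong (λ a → cong (p i a *ᶻ_) (hA ρ a b))))) ⟩
    sum (λ b → sum (λ a → p i a *ᶻ sum (λ k → l a k *ᶻ (e k *ᶻ l b k))) *ᶻ p j b)
  ≡⟨ contract-congruence (p i) (p j) e l ⟩
    sum (λ k → sum (λ a → p i a *ᶻ l a k) *ᶻ (e k *ᶻ sum (λ b → p j b *ᶻ l b k)))
  ≡⟨ sum-cong (λ k → cong₂ (λ x y → x *ᶻ (e k *ᶻ y))
       (inverse-left ρ L (hL ρ) i k) (inverse-left ρ L (hL ρ) j k)) ⟩
    sum (λ k → δ i k *ᶻ (e k *ᶻ δ j k))
  ≡⟨ sum-δ i (λ k → e k *ᶻ δ j k) ⟩
    e i *ᶻ δ j i
  ≡⟨ diag-δ d ρ i j ⟩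
    ⟦ diag d i j ⟧ ρ
  ∎
  where
  p l : Fin n → Fin n → ℤ
  p a b = ⟦ inverse L a b ⟧ ρ
  l a b = ⟦ L a b ⟧ ρ
  e : Fin n → ℤ
  e k = ⟦ d k ⟧ ρ

congruence-SSNF : ∀ {n} (A L : Mat n n) (d : Fin n → Poly) →
  (∀ ρ → IsLowerUnitriangular ρ L) →
  (∀ ρ i j → ⟦ A i j ⟧ ρ ≡ sum (λ k → ⟦ L i k ⟧ ρ *ᶻ (⟦ d k ⟧ ρ *ᶻ ⟦ L j k ⟧ ρ))) →
  (∀ i j → toℕ j ≤ toℕ i → d j ∣ₚ d i) →
  IsSSNF A (diag d)
congruence-SSNF A L d hL hA chain =
  ( inverse L , transpose (inverse L) , det-inverse L , det-inverse-transpose L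
  , congruence-diagonalises A L d hL hA )
  , diag-isDiagonal d
  , λ i j i' j' i≡i' j≡j' j≤i →
      subst₂ _∣ₚ_ (sym (diag-on-diagonal d j j' j≡j')) (sym (diag-on-diagonal d i i' i≡i'))
        (chain i j j≤i)

s-divides : ∀ {a b} → a ≤′ b → s a ∣ₚ s b
s-divides ≤′-refl = 𝟙 , λ ρ → ℤₚ.*-identityˡ _
s-divides {a} {suc b} (≤′-step a≤b) with s-divides a≤b
... | c , c·sa≈sb = c ⊗ var (suc b) , λ ρ →
  trans (swap (⟦ c ⟧ ρ) (ρ (suc b)) (⟦ s a ⟧ ρ)) (cong (_*ᶻ ρ (suc b)) (c·sa≈sb ρ))
  where
  swap : ∀ x y z → x *ᶻ y *ᶻ z ≡ x *ᶻ z *ᶻ y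
  swap = solve-∀

-- The one-step transfers on height-indexed weight sequences: prepending a
-- step to paths ending at 0, and appending a step to paths starting at 0
-- (a down step from height h+1 weighs c (h+1)).
prependStep appendStep : (ℕ → ℤ) → (ℕ → ℤ) → (ℕ → ℤ)
prependStep c b zero = b 1
prependStep c b (suc k) = b (suc (suc k)) +ᶻ c (suc k) *ᶻ b k
appendStep c a zero = c 1 *ᶻ a 1
appendStep c a (suc k) = a k +ᶻ c (suc (suc k)) *ᶻ a (suc (suc k))

-- toGround ρ m h: total weight of the m-step paths from height h to 0.
toGround : (ℕ → ℤ) → ℕ → ℕ → ℤ
toGround ρ zero zero = + 1
toGround ρ zero (suc h) = +0
toGround ρ (suc m) = prependStep ρ (toGround ρ m)

weightOf : (ℕ → ℤ) → Maybe Poly → ℤ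
weightOf ρ (just p) = ⟦ p ⟧ ρ
weightOf ρ nothing = +0

weightFrom : (ℕ → ℤ) → ℕ → List (List Bool) → ℤ
weightFrom ρ h [] = +0
weightFrom ρ h (bs ∷ bss) = weightOf ρ (walk h bs) +ᶻ weightFrom ρ h bss

⟦sumWeights⟧ : ∀ ρ bss → ⟦ sumWeights bss ⟧ ρ ≡ weightFrom ρ 0 bss
⟦sumWeights⟧ ρ [] = refl
⟦sumWeights⟧ ρ (bs ∷ bss) with walk 0 bs
... | just w = cong (⟦ w ⟧ ρ +ᶻ_) (⟦sumWeights⟧ ρ bss)
... | nothing = trans (⟦sumWeights⟧ ρ bss) (sym (ℤₚ.+-identityˡ _))

weightFrom-++ : ∀ ρ h xs ys → weightFrom ρ h (xs ++ ys) ≡ weightFrom ρ h xs +ᶻ weightFrom ρ h ys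
weightFrom-++ ρ h [] ys = sym (ℤₚ.+-identityˡ _)
weightFrom-++ ρ h (x ∷ xs) ys =
  trans (cong (weightOf ρ (walk h x) +ᶻ_) (weightFrom-++ ρ h xs ys))
    (sym (ℤₚ.+-assoc (weightOf ρ (walk h x)) (weightFrom ρ h xs) (weightFrom ρ h ys)))

weightFrom-up : ∀ ρ h bss → weightFrom ρ h (map (true ∷_) bss) ≡ weightFrom ρ (suc h) bss
weightFrom-up ρ h [] = refl
weightFrom-up ρ h (bs ∷ bss) = cong₂ _+ᶻ_ (cong (weightOf ρ) (walk-up h)) (weightFrom-up ρ h bss)
  where
  walk-up : ∀ h → walk h (true ∷ bs) ≡ walk (suc h) bs
  walk-up zero = refl
  walk-up (suc h) = refl

weightFrom-down-0 : ∀ ρ bss → weightFrom ρ 0 (map (false ∷_) bss) ≡ +0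
weightFrom-down-0 ρ [] = refl
weightFrom-down-0 ρ (bs ∷ bss) = trans (ℤₚ.+-identityˡ _) (weightFrom-down-0 ρ bss)

weightFrom-down : ∀ ρ h bss →
  weightFrom ρ (suc h) (map (false ∷_) bss) ≡ ρ (suc h) *ᶻ weightFrom ρ h bss
weightFrom-down ρ h [] = sym (ℤₚ.*-zeroʳ (ρ (suc h)))
weightFrom-down ρ h (bs ∷ bss) with walk h bs
... | just w = trans (cong (ρ (suc h) *ᶻ ⟦ w ⟧ ρ +ᶻ_) (weightFrom-down ρ h bss))
  (sym (ℤₚ.*-distribˡ-+ (ρ (suc h)) (⟦ w ⟧ ρ) (weightFrom ρ h bss)))
... | nothing = trans (ℤₚ.+-identityˡ _)
  (trans (weightFrom-down ρ h bss) (cong (ρ (suc h) *ᶻ_) (sym (ℤₚ.+-identityˡ _))))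

-- Splitting all step sequences on their first step yields the recursion of toGround.
weightFrom-allSeqs : ∀ ρ m h → weightFrom ρ h (allSeqs m) ≡ toGround ρ m h
weightFrom-allSeqs ρ zero zero = refl
weightFrom-allSeqs ρ zero (suc h) = refl
weightFrom-allSeqs ρ (suc m) zero =
  trans (weightFrom-++ ρ 0 (map (true ∷_) (allSeqs m)) _)
    (trans (cong₂ _+ᶻ_ (trans (weightFrom-up ρ 0 (allSeqs m)) (weightFrom-allSeqs ρ m 1))
                        (weightFrom-down-0 ρ (allSeqs m)))
      (ℤₚ.+-identityʳ _))
weightFrom-allSeqs ρ (suc m) (suc h) =
  trans (weightFrom-++ ρ (suc h) (map (true ∷_) (allSeqs m)) _)
    (cong₂ _+ᶻ_ (trans (weightFrom-up ρ (suc h) (allSeqs m)) (weightFrom-allSeqs ρ m (suc (suc h))))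
                 (trans (weightFrom-down ρ h (allSeqs m)) (cong (ρ (suc h) *ᶻ_) (weightFrom-allSeqs ρ m h))))

⟦μ⟧ : ∀ ρ m → ⟦ μ m ⟧ ρ ≡ toGround ρ m 0
⟦μ⟧ ρ m = trans (⟦sumWeights⟧ ρ (allSeqs m)) (weightFrom-allSeqs ρ m 0)

-- ballot i k: weight of the i-step paths from height 0 to height k,
-- split on the last step.
ballot : ℕ → ℕ → Poly
ballot zero zero = 𝟙
ballot zero (suc k) = 𝟘
ballot (suc i) zero = var 1 ⊗ ballot i 1
ballot (suc i) (suc k) = ballot i k ⊕ var (suc (suc k)) ⊗ ballot i (suc (suc k))

ℬ : (ℕ → ℤ) → ℕ → ℕ → ℤ
ℬ ρ i k = ⟦ ballot i k ⟧ ρ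

ballot-step : ∀ ρ i k → ℬ ρ (suc i) k ≡ appendStep ρ (ℬ ρ i) k
ballot-step ρ i zero = refl
ballot-step ρ i (suc k) = refl

-- A path of i steps cannot climb higher than i …
ballot-above-diagonal : ∀ ρ i k → i < k → ℬ ρ i k ≡ +0
ballot-above-diagonal ρ zero (suc k) _ = refl
ballot-above-diagonal ρ (suc i) (suc k) (s≤s i<k) =
  trans (cong₂ (λ x y → x +ᶻ ρ (suc (suc k)) *ᶻ y)
          (ballot-above-diagonal ρ i k i<k)
          (ballot-above-diagonal ρ i (suc (suc k)) (ℕₚ.m<n⇒m<1+n (ℕₚ.m<n⇒m<1+n i<k))))
    (trans (ℤₚ.+-identityˡ _) (ℤₚ.*-zeroʳ (ρ (suc (suc k)))))

-- … and climbs to exactly i in a unique way, of weight 1.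
ballot-diagonal : ∀ ρ i → ℬ ρ i i ≡ + 1
ballot-diagonal ρ zero = refl
ballot-diagonal ρ (suc i) =
  trans (cong₂ (λ x y → x +ᶻ ρ (suc (suc i)) *ᶻ y)
          (ballot-diagonal ρ i)
          (ballot-above-diagonal ρ i (suc (suc i)) (ℕₚ.m<n⇒m<1+n ℕₚ.≤-refl)))
    (cong (+ 1 +ᶻ_) (ℤₚ.*-zeroʳ (ρ (suc (suc i)))))

-- A path of i steps ending at height k has i + k even.
ballot-odd : ∀ ρ i k → parity (i + k) ≡ 1ℙ → ℬ ρ i k ≡ +0
ballot-odd ρ zero zero ()
ballot-odd ρ zero (suc k) _ = refl
ballot-odd ρ (suc i) zero odd =
  trans (cong (ρ 1 *ᶻ_) (ballot-odd ρ i 1 (trans (cong parity (ℕₚ.+-suc i 0)) odd)))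
    (ℤₚ.*-zeroʳ (ρ 1))
ballot-odd ρ (suc i) (suc k) odd =
  trans (cong₂ (λ x y → x +ᶻ ρ (suc (suc k)) *ᶻ y) (ballot-odd ρ i k odd′) (ballot-odd ρ i (suc (suc k)) odd″))
    (trans (ℤₚ.+-identityˡ _) (ℤₚ.*-zeroʳ (ρ (suc (suc k)))))
  where
  odd′ : parity (i + k) ≡ 1ℙ
  odd′ = trans (cong (λ m → parity (suc m)) (sym (ℕₚ.+-suc i k))) odd
  odd″ : parity (i + suc (suc k)) ≡ 1ℙ
  odd″ = trans (cong parity (trans (ℕₚ.+-suc i (suc k)) (cong suc (ℕₚ.+-suc i k)))) odd′

-- Reversing a path from height k to 0: the down steps from heights 1, …, k are
-- forced, the rest pair up into a reversed path from 0 to k.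
toGround-ballot : ∀ ρ j k → toGround ρ j k ≡ ⟦ s k ⟧ ρ *ᶻ ℬ ρ j k
toGround-ballot ρ zero zero = refl
toGround-ballot ρ zero (suc k) = sym (ℤₚ.*-zeroʳ (⟦ s (suc k) ⟧ ρ))
toGround-ballot ρ (suc j) zero = trans (toGround-ballot ρ j 1) (regroup (ρ 1) (ℬ ρ j 1))
  where
  regroup : ∀ r x → (+ 1 *ᶻ r) *ᶻ x ≡ + 1 *ᶻ (r *ᶻ x)
  regroup = solve-∀
toGround-ballot ρ (suc j) (suc k) =
  trans (cong₂ (λ x y → x +ᶻ ρ (suc k) *ᶻ y) (toGround-ballot ρ j (suc (suc k))) (toGround-ballot ρ j k))
    (regroup (⟦ s k ⟧ ρ) (ρ (suc k)) (ρ (suc (suc k))) (ℬ ρ j k) (ℬ ρ j (suc (suc k))))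
  where
  regroup : ∀ S r₁ r₂ l₀ l₂ → (S *ᶻ r₁ *ᶻ r₂) *ᶻ l₂ +ᶻ r₁ *ᶻ (S *ᶻ l₀) ≡ (S *ᶻ r₁) *ᶻ (l₀ +ᶻ r₂ *ᶻ l₂)
  regroup = solve-∀

-- Appending is adjoint to prepending for the pairing Σ_{k ≤ N} a_k b_k,
-- up to boundary terms at N.
transfer-adjoint : ∀ c a b N →
  sumTo (suc N) (λ k → appendStep c a k *ᶻ b k) +ᶻ a N *ᶻ b (suc N)
  ≡ sumTo (suc N) (λ k → a k *ᶻ prependStep c b k) +ᶻ c (suc N) *ᶻ a (suc N) *ᶻ b N
transfer-adjoint c a b zero = swap (c 1) (a 1) (b 0) (a 0) (b 1)
  where
  swap : ∀ c₁ a₁ b₀ a₀ b₁ → c₁ *ᶻ a₁ *ᶻ b₀ +ᶻ +0 +ᶻ a₀ *ᶻ b₁ ≡ a₀ *ᶻ b₁ +ᶻ +0 +ᶻ c₁ *ᶻ a₁ *ᶻ b₀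
  swap = solve-∀
transfer-adjoint c a b (suc N) =
  begin
    sumTo (suc (suc N)) (λ k → appendStep c a k *ᶻ b k) +ᶻ a (suc N) *ᶻ b (suc (suc N))
  ≡⟨ cong (_+ᶻ a (suc N) *ᶻ b (suc (suc N))) (sumTo-last (suc N) (λ k → appendStep c a k *ᶻ b k)) ⟩
    S +ᶻ (a N +ᶻ Z) *ᶻ b (suc N) +ᶻ a (suc N) *ᶻ b (suc (suc N))
  ≡⟨ split-last S (a N) (b (suc N)) Z (a (suc N) *ᶻ b (suc (suc N))) ⟩
    (S +ᶻ a N *ᶻ b (suc N)) +ᶻ (Z *ᶻ b (suc N) +ᶻ a (suc N) *ᶻ b (suc (suc N)))
  ≡⟨ cong (_+ᶻ (Z *ᶻ b (suc N) +ᶻ a (suc N) *ᶻ b (suc (suc N)))) (transfer-adjoint c a b N) ⟩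
    (R +ᶻ c (suc N) *ᶻ a (suc N) *ᶻ b N) +ᶻ (Z *ᶻ b (suc N) +ᶻ a (suc N) *ᶻ b (suc (suc N)))
  ≡⟨ merge-last R (c (suc N)) (a (suc N)) (b N) (Z *ᶻ b (suc N)) (b (suc (suc N))) ⟩
    R +ᶻ a (suc N) *ᶻ prependStep c b (suc N) +ᶻ Z *ᶻ b (suc N)
  ≡⟨ cong (_+ᶻ Z *ᶻ b (suc N)) (sym (sumTo-last (suc N) (λ k → a k *ᶻ prependStep c b k))) ⟩
    sumTo (suc (suc N)) (λ k → a k *ᶻ prependStep c b k) +ᶻ c (suc (suc N)) *ᶻ a (suc (suc N)) *ᶻ b (suc N)
  ∎
  where
  S R Z : ℤ
  S = sumTo (suc N) (λ k → appendStep c a k *ᶻ b k)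
  R = sumTo (suc N) (λ k → a k *ᶻ prependStep c b k)
  Z = c (suc (suc N)) *ᶻ a (suc (suc N))
  split-last : ∀ S x y z t → S +ᶻ (x +ᶻ z) *ᶻ y +ᶻ t ≡ (S +ᶻ x *ᶻ y) +ᶻ (z *ᶻ y +ᶻ t)
  split-last = solve-∀
  merge-last : ∀ R c₁ a₁ b₀ Z b₂ → (R +ᶻ c₁ *ᶻ a₁ *ᶻ b₀) +ᶻ (Z +ᶻ a₁ *ᶻ b₂) ≡ R +ᶻ a₁ *ᶻ (b₂ +ᶻ c₁ *ᶻ b₀) +ᶻ Z
  merge-last = solve-∀

transfer-adjoint-interior : ∀ c a b N → a N ≡ +0 → a (suc N) ≡ +0 →
  sumTo (suc N) (λ k → appendStep c a k *ᶻ b k) ≡ sumTo (suc N) (λ k → a k *ᶻ prependStep c b k)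
transfer-adjoint-interior c a b N aN≡0 aN+1≡0 =
  begin
    X                                   ≡⟨ sym (ℤₚ.+-identityʳ X) ⟩
    X +ᶻ +0 *ᶻ b (suc N)                 ≡⟨ cong (λ z → X +ᶻ z *ᶻ b (suc N)) (sym aN≡0) ⟩
    X +ᶻ a N *ᶻ b (suc N)                ≡⟨ transfer-adjoint c a b N ⟩
    Y +ᶻ c (suc N) *ᶻ a (suc N) *ᶻ b N   ≡⟨ cong (λ z → Y +ᶻ c (suc N) *ᶻ z *ᶻ b N) aN+1≡0 ⟩
    Y +ᶻ c (suc N) *ᶻ +0 *ᶻ b N          ≡⟨ cong (λ z → Y +ᶻ z *ᶻ b N) (ℤₚ.*-zeroʳ (c (suc N))) ⟩
    Y +ᶻ +0                             ≡⟨ ℤₚ.+-identityʳ Y ⟩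
    Y                                   ∎
  where
  X Y : ℤ
  X = sumTo (suc N) (λ k → appendStep c a k *ᶻ b k)
  Y = sumTo (suc N) (λ k → a k *ᶻ prependStep c b k)

-- Cutting a path from 0 to 0 of length i + j after its first i steps.
toGround-split : ∀ ρ i j N → i < N →
  toGround ρ (i + j) 0 ≡ sumTo N (λ k → ℬ ρ i k *ᶻ toGround ρ j k)
toGround-split ρ zero j (suc N) _ =
  sym (trans (cong (+ 1 *ᶻ toGround ρ j 0 +ᶻ_) (sumTo-zero N _ (λ _ → refl)))
         (trans (ℤₚ.+-identityʳ _) (ℤₚ.*-identityˡ _)))
toGround-split ρ (suc i) j (suc N) (s≤s i<N) =
  begin
    toGround ρ (suc i + j) 0
  ≡⟨ cong (λ m → toGround ρ m 0) (sym (ℕₚ.+-suc i j)) ⟩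
    toGround ρ (i + suc j) 0
  ≡⟨ toGround-split ρ i (suc j) (suc N) (ℕₚ.m<n⇒m<1+n i<N) ⟩
    sumTo (suc N) (λ k → ℬ ρ i k *ᶻ prependStep ρ (toGround ρ j) k)
  ≡⟨ sym (transfer-adjoint-interior ρ (ℬ ρ i) (toGround ρ j) N
       (ballot-above-diagonal ρ i N i<N) (ballot-above-diagonal ρ i (suc N) (ℕₚ.m<n⇒m<1+n i<N))) ⟩
    sumTo (suc N) (λ k → appendStep ρ (ℬ ρ i) k *ᶻ toGround ρ j k)
  ≡⟨ sumTo-cong (suc N) (λ k → cong (_*ᶻ toGround ρ j k) (sym (ballot-step ρ i k))) ⟩
    sumTo (suc N) (λ k → ℬ ρ (suc i) k *ᶻ toGround ρ j k)
  ∎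

moment-factorisation : ∀ ρ a b N → a < N →
  ⟦ μ (a + b) ⟧ ρ ≡ sumTo N (λ k → ℬ ρ a k *ᶻ (⟦ s k ⟧ ρ *ᶻ ℬ ρ b k))
moment-factorisation ρ a b N a<N =
  trans (⟦μ⟧ ρ (a + b)) (trans (toGround-split ρ a b N a<N)
    (sumTo-cong N (λ k → cong (ℬ ρ a k *ᶻ_) (toGround-ballot ρ b k))))

parity-double : ∀ k → parity (2 * k) ≡ 0ℙ
parity-double k = Parityₚ.*-homo-* 2 k

parity-double+1 : ∀ k → parity (2 * k + 1) ≡ 1ℙ
parity-double+1 k = trans (Parityₚ.+-homo-+ (2 * k) 1) (cong (_+ℙ 1ℙ) (parity-double k))

-- Restricted to even indices only even heights contribute …
moment-factorisation-even : ∀ ρ a b n → a < n →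
  ⟦ μ (2 * a + 2 * b) ⟧ ρ ≡ sumTo n (λ k → ℬ ρ (2 * a) (2 * k) *ᶻ (⟦ s (2 * k) ⟧ ρ *ᶻ ℬ ρ (2 * b) (2 * k)))
moment-factorisation-even ρ a b n a<n =
  trans (moment-factorisation ρ (2 * a) (2 * b) (2 * n) (ℕₚ.*-monoʳ-< 2 a<n))
    (trans (sumTo-parity-split n g)
      (trans (cong (sumTo n (λ k → g (2 * k)) +ᶻ_) (sumTo-zero n (λ k → g (2 * k + 1)) odd-heights-vanish)) (ℤₚ.+-identityʳ _)))
  where
  g : ℕ → ℤ
  g k = ℬ ρ (2 * a) k *ᶻ (⟦ s k ⟧ ρ *ᶻ ℬ ρ (2 * b) k)
  odd-heights-vanish : ∀ k → g (2 * k + 1) ≡ +0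
  odd-heights-vanish k = cong (_*ᶻ _) (ballot-odd ρ (2 * a) (2 * k + 1)
    (trans (Parityₚ.+-homo-+ (2 * a) (2 * k + 1))
      (cong₂ _+ℙ_ (parity-double a) (parity-double+1 k))))

-- … and restricted to odd indices only odd heights do.
moment-factorisation-odd : ∀ ρ a b n → a < n →
  ⟦ μ (2 * a + 2 * b + 2) ⟧ ρ
  ≡ sumTo n (λ k → ℬ ρ (2 * a + 1) (2 * k + 1) *ᶻ (⟦ s (2 * k + 1) ⟧ ρ *ᶻ ℬ ρ (2 * b + 1) (2 * k + 1)))
moment-factorisation-odd ρ a b n a<n =
  trans (cong (λ m → ⟦ μ m ⟧ ρ) (odd+odd a b))
    (trans (moment-factorisation ρ (2 * a + 1) (2 * b + 1) (2 * n) 2a+1<2n)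
      (trans (sumTo-parity-split n g)
        (trans (cong (_+ᶻ sumTo n (λ k → g (2 * k + 1))) (sumTo-zero n (λ k → g (2 * k)) even-heights-vanish)) (ℤₚ.+-identityˡ _))))
  where
  odd+odd : ∀ a b → 2 * a + 2 * b + 2 ≡ (2 * a + 1) + (2 * b + 1)
  odd+odd = ℕ-Solver.solve-∀
  double-suc : ∀ a → suc (2 * a + 1) ≡ 2 * suc a
  double-suc = ℕ-Solver.solve-∀
  2a+1<2n : 2 * a + 1 < 2 * n
  2a+1<2n = subst (_≤ 2 * n) (sym (double-suc a)) (ℕₚ.*-monoʳ-≤ 2 a<n)
  g : ℕ → ℤ
  g k = ℬ ρ (2 * a + 1) k *ᶻ (⟦ s k ⟧ ρ *ᶻ ℬ ρ (2 * b + 1) k)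
  even-heights-vanish : ∀ k → g (2 * k) ≡ +0
  even-heights-vanish k = cong (_*ᶻ _) (ballot-odd ρ (2 * a + 1) (2 * k)
    (trans (Parityₚ.+-homo-+ (2 * a + 1) (2 * k))
      (cong₂ _+ℙ_ (parity-double+1 a) (parity-double k))))

strict⇒monotone : ∀ {f : ℕ → ℕ} → f Preserves _<_ ⟶ _<_ → f Preserves _≤_ ⟶ _≤_
strict⇒monotone f-mono x≤y with ℕₚ.m≤n⇒m<n∨m≡n x≤y
... | inj₁ x<y = ℕₚ.<⇒≤ (f-mono x<y)
... | inj₂ refl = ℕₚ.≤-refl

ballot-SSNF : ∀ n (A : Mat (suc n) (suc n)) (f : ℕ → ℕ) → f Preserves _<_ ⟶ _<_ →
  (∀ ρ (i j : Fin (suc n)) → ⟦ A i j ⟧ ρ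
     ≡ sumTo (suc n) (λ k → ℬ ρ (f (toℕ i)) (f k) *ᶻ (⟦ s (f k) ⟧ ρ *ᶻ ℬ ρ (f (toℕ j)) (f k)))) →
  IsSSNF A (diag (λ i → s (f (toℕ i))))
ballot-SSNF n A f f-mono factorisation =
  congruence-SSNF A (λ i k → ballot (f (toℕ i)) (f (toℕ k))) (λ i → s (f (toℕ i)))
    (λ ρ → (λ i k i<k → ballot-above-diagonal ρ (f (toℕ i)) (f (toℕ k)) (f-mono i<k))
         , (λ i → ballot-diagonal ρ (f (toℕ i))))
    factorisation
    (λ i j j≤i → s-divides (ℕₚ.≤⇒≤′ (strict⇒monotone f-mono j≤i)))

theorem4p9 : (n : ℕ) →
      IsSSNF {suc n} {suc n} (λ i j → μ (toℕ i + toℕ j)) (diag (λ i → s (toℕ i)))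
    × IsSSNF {suc n} {suc n} (λ i j → μ (2 * toℕ i + 2 * toℕ j)) (diag (λ i → s (2 * toℕ i)))
    × IsSSNF {suc n} {suc n} (λ i j → μ (2 * toℕ i + 2 * toℕ j + 2)) (diag (λ i → s (2 * toℕ i + 1)))
theorem4p9 n =
    ballot-SSNF n (λ i j → μ (toℕ i + toℕ j)) (λ x → x) (λ x<y → x<y)
      (λ ρ i j → moment-factorisation ρ (toℕ i) (toℕ j) (suc n) (Finₚ.toℕ<n i))
  , ballot-SSNF n (λ i j → μ (2 * toℕ i + 2 * toℕ j)) (2 *_) (ℕₚ.*-monoʳ-< 2)
      (λ ρ i j → moment-factorisation-even ρ (toℕ i) (toℕ j) (suc n) (Finₚ.toℕ<n i))
  , ballot-SSNF n (λ i j → μ (2 * toℕ i + 2 * toℕ j + 2)) (λ x → 2 * x + 1) (λ x<y → ℕₚ.+-monoˡ-< 1 (ℕₚ.*-monoʳ-< 2 x<y))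
      (λ ρ i j → moment-factorisation-odd ρ (toℕ i) (toℕ j) (suc n) (Finₚ.toℕ<n i))
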